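{- Let $n\ge 1$ and let $g_1,g_2,h:\{0,1\}^n\to\{0,1\}$ be Boolean functions with $h\neq 1$ (i.e. $h$ is not the constant function $1$). Let $P_1\in\mathcal{P}_{g_1,h}$ and $P_2\in\mathcal{P}_{g_2,h}$. Then both compositions $P_1\circ P_2$ and $P_2\circ P_1$ belong to $\mathcal{P}_{g_1 . g_2,\,h}$.
   Context: Boolean functions are maps $\{0,1\}^n\to\{0,1\}$; $f.g$ (or $fg$) denotes pointwise AND, $f+g$ pointwise OR, $f'$ the complement. For a Boolean function $g$, $g_{ON}=\{x: g(x)=1\}$ and $g_{OFF}=\{x:g(x)=0\}$. A projection is any map $P:\{0,1\}^n\to\{0,1\}^n$. For Boolean functions $g,h$, $\mathcal{P}_{g,h}$ denotes the set of all maps $P:\{0,1\}^n\to\{0,1\}^n$ such that $P(x)=x$ for every $x\in g_{ON}$ and $P(x)\in h_{OFF}$ for every $x\in g_{OFF}$ (the image point may be chosen independently for each $x\in g_{OFF}$). -}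

module Defs where

open import Data.Bool using (Bool; true; false; _∧_)
open import Data.Nat using (ℕ)
open import Data.Vec using (Vec)
open import Data.Product using (_×_)
open import Relation.Binary.PropositionalEquality using (_≡_)

Cube : ℕ → Set
Cube n = Vec Bool n

BoolFun : ℕ → Set
BoolFun n = Cube n → Bool

Proj : ℕ → Set
Proj n = Cube n → Cube n

_·_ : ∀ {n} → BoolFun n → BoolFun n → BoolFun n
(f · g) x = f x ∧ g x

InP : ∀ {n} → BoolFun n → BoolFun n → Proj n → Set
InP g h P = ∀ x → (g x ≡ true → P x ≡ x) × (g x ≡ false → h (P x) ≡ false)

-- A map in 𝒫_{g,h} sends h_OFF into h_OFF: points of g_ON ∩ h_OFF are fixed,
-- and points of g_OFF land in h_OFF anyway.  So under P₁ ∘ P₂ a point of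
-- (g₁g₂)_ON is fixed by both maps, while a point of (g₁g₂)_OFF reaches h_OFF
-- at whichever step sees a vanishing gᵢ and stays there.  The other order
-- follows by commutativity of the product.
module Submission where

open import Defs
open import Data.Bool using (Bool; true; false)
open import Data.Bool.Properties using (∧-comm)
open import Data.Nat using (ℕ; _≥_)
open import Data.Product using (_×_; _,_; proj₁; proj₂)
open import Function using (_∘_)
open import Relation.Nullary using (¬_)
open import Relation.Binary.PropositionalEquality using (_≡_; trans; cong)

module _ {n : ℕ} (g h : BoolFun n) {P : Proj n} (P∈ : InP g h P) where

  InP-fixes-ON : ∀ {x} → g x ≡ true → P x ≡ x
  InP-fixes-ON {x} = proj₁ (P∈ x)

  InP-maps-OFF : ∀ {x} → g x ≡ false → h (P x) ≡ false
  InP-maps-OFF {x} = proj₂ (P∈ x)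

  InP-preserves-hOFF : ∀ y → h y ≡ false → h (P y) ≡ false
  InP-preserves-hOFF y hy with g y in gy
  ... | true  = trans (cong h (InP-fixes-ON gy)) hy
  ... | false = InP-maps-OFF gy

InP-∘ : ∀ {n} (g₁ g₂ h : BoolFun n) {P₁ P₂ : Proj n} →
  InP g₁ h P₁ → InP g₂ h P₂ → InP (g₁ · g₂) h (P₁ ∘ P₂)
InP-∘ g₁ g₂ h {P₁} {P₂} P₁∈ P₂∈ x with g₁ x in g₁x | g₂ x in g₂x
... | true  | true  = (λ _ → trans (cong P₁ P₂x≡x) (InP-fixes-ON g₁ h P₁∈ g₁x)) , λ ()
  where P₂x≡x = InP-fixes-ON g₂ h P₂∈ g₂x
... | false | true  = (λ ()) , λ _ → trans (cong (h ∘ P₁) P₂x≡x) (InP-maps-OFF g₁ h P₁∈ g₁x)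
  where P₂x≡x = InP-fixes-ON g₂ h P₂∈ g₂x
... | true  | false = (λ ()) , λ _ → P₁P₂x-OFF
  where P₁P₂x-OFF = InP-preserves-hOFF g₁ h P₁∈ (P₂ x) (InP-maps-OFF g₂ h P₂∈ g₂x)
... | false | false = (λ ()) , λ _ → P₁P₂x-OFF
  where P₁P₂x-OFF = InP-preserves-hOFF g₁ h P₁∈ (P₂ x) (InP-maps-OFF g₂ h P₂∈ g₂x)

InP-·-comm : ∀ {n} (g₁ g₂ h : BoolFun n) {P : Proj n} →
  InP (g₂ · g₁) h P → InP (g₁ · g₂) h P
InP-·-comm g₁ g₂ h P∈ x rewrite ∧-comm (g₁ x) (g₂ x) = P∈ x

lemma1 : (n : ℕ) → n ≥ 1 → (g₁ g₂ h : BoolFun n) → ¬ (∀ x → h x ≡ true) →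
    (P₁ P₂ : Proj n) → InP g₁ h P₁ → InP g₂ h P₂ →
    InP (g₁ · g₂) h (P₁ ∘ P₂) × InP (g₁ · g₂) h (P₂ ∘ P₁)
lemma1 _ _ g₁ g₂ h _ _ _ P₁∈ P₂∈ =
  InP-∘ g₁ g₂ h P₁∈ P₂∈ , InP-·-comm g₁ g₂ h (InP-∘ g₂ g₁ h P₂∈ P₁∈)
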